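{- Let $p$ be a prime, $d\ge 1$ an integer, and $f(x,y)=ax^d+bxy^{d-1}+cy^d\in\mathbb{Q}_p[x,y]$ with $a,c\in\mathbb{Z}_p$ but $b\notin\mathbb{Z}_p$. Then there exist $\alpha,\beta\in\mathbb{Q}_p$, not both zero, with $f(\alpha,\beta)=0$. -}

module Defs where

open import Data.Nat using (ℕ; zero; suc; _+_; _*_; _^_; NonZero)
open import Data.Nat.Properties using (m^n≢0)
open import Data.Nat.DivMod using (_/_; _mod_)
open import Data.Fin using (Fin; toℕ)
open import Data.Product using (_×_; _,_; ∃)
open import Relation.Binary.PropositionalEquality using (_≡_)

module Padic (p : ℕ) .{{p≢0 : NonZero p}} where

  -- A p-adic integer is its digit expansion  x = Σ_{i ≥ 0} x(i) · p^i ,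
  -- digits in {0,…,p-1}.  Every such function is a p-adic integer and
  -- distinct functions are distinct p-adic integers.
  ℤp : Set
  ℤp = ℕ → Fin p

  res : ℤp → ℕ → ℕ
  res x zero    = 0
  res x (suc n) = res x n + toℕ (x n) * p ^ n

  -- Given r with r n ≡ (true value) mod p^n for all n, the digit sequence
  -- of that value: the n-th digit is ⌊ r(n+1) / p^n ⌋ mod p.
  fromRes : (ℕ → ℕ) → ℤp
  fromRes r n = ((r (suc n) / p ^ n) {{m^n≢0 p n}}) mod p

  _≈ᶻ_ : ℤp → ℤp → Set
  x ≈ᶻ y = ∀ n → x n ≡ y n

  ℕ→ℤp : ℕ → ℤp
  ℕ→ℤp m = fromRes (λ _ → m)

  _+ᶻ_ : ℤp → ℤp → ℤp
  x +ᶻ y = fromRes (λ n → res x n + res y n)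

  _*ᶻ_ : ℤp → ℤp → ℤp
  x *ᶻ y = fromRes (λ n → res x n * res y n)

  -- ℚ_p : a pair (k , u) represents u / p^k  (every p-adic number has this form)
  ℚp : Set
  ℚp = ℕ × ℤp

  ι : ℤp → ℚp
  ι u = (0 , u)

  _≈_ : ℚp → ℚp → Set
  (k , u) ≈ (l , v) = (ℕ→ℤp (p ^ l) *ᶻ u) ≈ᶻ (ℕ→ℤp (p ^ k) *ᶻ v)

  _+ℚ_ : ℚp → ℚp → ℚp
  (k , u) +ℚ (l , v) = (k + l , (ℕ→ℤp (p ^ l) *ᶻ u) +ᶻ (ℕ→ℤp (p ^ k) *ᶻ v))

  _*ℚ_ : ℚp → ℚp → ℚp
  (k , u) *ℚ (l , v) = (k + l , u *ᶻ v)

  0ℚ 1ℚ : ℚp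
  0ℚ = ι (ℕ→ℤp 0)
  1ℚ = ι (ℕ→ℤp 1)

  _^ℚ_ : ℚp → ℕ → ℚp
  x ^ℚ zero  = 1ℚ
  x ^ℚ suc n = x *ℚ (x ^ℚ n)

  infixl 6 _+ℚ_
  infixl 7 _*ℚ_
  infix 8 _^ℚ_
  infix 4 _≈_

  Integral : ℚp → Set
  Integral x = ∃ λ w → x ≈ ι w

{-# OPTIONS --safe #-}

-- Write b = u / p^k and let j < k index the first nonzero p-adic digit of u, so that
-- b = u′ / p^m with u′ a unit and m = k − j ≥ 1.  For β = 1 and α = p^m T the form
-- becomes H(T) = p^(md) a T^d + u′ T + c, which modulo p is the linear polynomial
-- u′ T + c with invertible slope.  Hensel's lemma therefore gives a root T ∈ ℤ_p, whose
-- digits are chosen one at a time by solving a linear congruence modulo p.  All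
-- identities in ℤ_p are checked on residues modulo p^n, where they become congruences
-- of natural numbers.

module Submission where

open import Defs
open import Data.Nat
open import Data.Nat.Properties
open import Data.Nat.DivMod
open import Data.Nat.Divisibility
open import Data.Nat.Primality using (Prime; prime⇒nonTrivial)
open import Data.Nat.Coprimality using (coprime-Bézout; prime⇒coprime)
open import Data.Nat.GCD using (module Bézout)
open import Data.Nat.Tactic.RingSolver using (solve-∀)
open import Data.Fin using (Fin; toℕ)
open import Data.Fin.Properties using (toℕ<n; toℕ-fromℕ<; toℕ-injective)
open import Data.Product
open import Data.Empty using (⊥-elim)
open import Data.Sum using (_⊎_; inj₁; inj₂; [_,_]′)
open import Relation.Nullary using (¬_; yes; no)
open import Level using (0ℓ)
open import Relation.Binary.Bundles using (Setoid)
open import Relation.Binary.PropositionalEquality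
import Relation.Binary.Reasoning.Setoid as SetoidReasoning

^-distribʳ-* : ∀ x y n → (x * y) ^ n ≡ x ^ n * y ^ n
^-distribʳ-* x y zero    = refl
^-distribʳ-* x y (suc n) = trans (cong (x * y *_) (^-distribʳ-* x y n)) (*-*-interchange x y (x ^ n) (y ^ n))
  where
  *-*-interchange : ∀ a b c d → a * b * (c * d) ≡ a * c * (b * d)
  *-*-interchange = solve-∀

-- Congruence modulo m, stated without truncated subtraction.
infix 4 _≡_[mod_]
record _≡_[mod_] (x y m : ℕ) : Set where
  constructor congruent
  field
    k l : ℕ
    equation : x + k * m ≡ y + l * m

module _ {m : ℕ} where
  open ≡-Reasoning

  ≡-mod-refl : ∀ {x} → x ≡ x [mod m ]
  ≡-mod-refl = congruent 0 0 refl

  ≡⇒≡-mod : ∀ {x y} → x ≡ y → x ≡ y [mod m ]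
  ≡⇒≡-mod refl = ≡-mod-refl

  ≡-mod-sym : ∀ {x y} → x ≡ y [mod m ] → y ≡ x [mod m ]
  ≡-mod-sym (congruent a b eq) = congruent b a (sym eq)

  ≡-mod-trans : ∀ {x y z} → x ≡ y [mod m ] → y ≡ z [mod m ] → x ≡ z [mod m ]
  ≡-mod-trans {x} {y} {z} (congruent a b x≡y) (congruent c d y≡z) = congruent (a + c) (d + b) (begin
    x + (a + c) * m    ≡⟨ split x a c ⟩
    x + a * m + c * m  ≡⟨ cong (_+ c * m) x≡y ⟩
    y + b * m + c * m  ≡⟨ +-*-swap y b c m ⟩
    y + c * m + b * m  ≡⟨ cong (_+ b * m) y≡z ⟩
    z + d * m + b * m  ≡⟨ split z d b ⟨
    z + (d + b) * m    ∎)
    where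
    split : ∀ x a c → x + (a + c) * m ≡ x + a * m + c * m
    split x a c = trans (cong (x +_) (*-distribʳ-+ m a c)) (sym (+-assoc x (a * m) (c * m)))
    +-*-swap : ∀ y b c m → y + b * m + c * m ≡ y + c * m + b * m
    +-*-swap = solve-∀

  +-cong-mod : ∀ {x y x′ y′} → x ≡ y [mod m ] → x′ ≡ y′ [mod m ] → x + x′ ≡ y + y′ [mod m ]
  +-cong-mod {x} {y} {x′} {y′} (congruent a b x≡y) (congruent a′ b′ x′≡y′) = congruent (a + a′) (b + b′) (begin
    x + x′ + (a + a′) * m        ≡⟨ regroup x x′ a a′ m ⟩
    (x + a * m) + (x′ + a′ * m)  ≡⟨ cong₂ _+_ x≡y x′≡y′ ⟩
    (y + b * m) + (y′ + b′ * m)  ≡⟨ regroup y y′ b b′ m ⟨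
    y + y′ + (b + b′) * m        ∎)
    where
    regroup : ∀ x x′ a a′ m → x + x′ + (a + a′) * m ≡ (x + a * m) + (x′ + a′ * m)
    regroup = solve-∀

  *-cong-mod : ∀ {x y x′ y′} → x ≡ y [mod m ] → x′ ≡ y′ [mod m ] → x * x′ ≡ y * y′ [mod m ]
  *-cong-mod {x} {y} {x′} {y′} (congruent a b x≡y) (congruent a′ b′ x′≡y′) =
    congruent (a * x′ + x * a′ + a * a′ * m) (b * y′ + y * b′ + b * b′ * m) (begin
    x * x′ + (a * x′ + x * a′ + a * a′ * m) * m  ≡⟨ expand x x′ a a′ m ⟩
    (x + a * m) * (x′ + a′ * m)                  ≡⟨ cong₂ _*_ x≡y x′≡y′ ⟩
    (y + b * m) * (y′ + b′ * m)                  ≡⟨ expand y y′ b b′ m ⟨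
    y * y′ + (b * y′ + y * b′ + b * b′ * m) * m  ∎)
    where
    expand : ∀ x x′ a a′ m → x * x′ + (a * x′ + x * a′ + a * a′ * m) * m ≡ (x + a * m) * (x′ + a′ * m)
    expand = solve-∀

  +-congʳ-mod : ∀ {x y} z → x ≡ y [mod m ] → x + z ≡ y + z [mod m ]
  +-congʳ-mod z x≡y = +-cong-mod x≡y (≡-mod-refl {x = z})

  *-congˡ-mod : ∀ z {x y} → x ≡ y [mod m ] → z * x ≡ z * y [mod m ]
  *-congˡ-mod z x≡y = *-cong-mod (≡-mod-refl {x = z}) x≡y

  ^-cong-mod : ∀ {x y} n → x ≡ y [mod m ] → x ^ n ≡ y ^ n [mod m ]
  ^-cong-mod zero    x≡y = ≡-mod-refl
  ^-cong-mod (suc n) x≡y = *-cong-mod x≡y (^-cong-mod n x≡y)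

  +-*-mod : ∀ x k → x + k * m ≡ x [mod m ]
  +-*-mod x k = congruent 0 k (+-identityʳ (x + k * m))

  ∣⇒≡0-mod : ∀ {x} → m ∣ x → x ≡ 0 [mod m ]
  ∣⇒≡0-mod (divides q refl) = congruent 0 q (+-identityʳ (q * m))

  ≡0-mod⇒∣ : ∀ {x} → x ≡ 0 [mod m ] → m ∣ x
  ≡0-mod⇒∣ {x} (congruent a b eq) = ∣m+n∣m⇒∣n (divides b (trans (+-comm (a * m) x) eq)) (n∣m*n a)

  *-scaleʳ-mod : ∀ {x y} k → x ≡ y [mod m ] → x * k ≡ y * k [mod m * k ]
  *-scaleʳ-mod {x} {y} k (congruent a b x≡y) = congruent a b (begin
    x * k + a * (m * k)  ≡⟨ factor x a k m ⟩
    (x + a * m) * k      ≡⟨ cong (_* k) x≡y ⟩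
    (y + b * m) * k      ≡⟨ factor y b k m ⟨
    y * k + b * (m * k)  ∎)
    where
    factor : ∀ x a k m → x * k + a * (m * k) ≡ (x + a * m) * k
    factor = solve-∀

  ∣-scaleˡ-mod : ∀ {k e x y} → k ∣ e → x ≡ y [mod m ] → e * x ≡ e * y [mod k * m ]
  ∣-scaleˡ-mod {k} {e} {x} {y} (divides q refl) (congruent a b x≡y) = congruent (q * a) (q * b) (begin
    q * k * x + q * a * (k * m)  ≡⟨ factor q k x a m ⟩
    q * k * (x + a * m)          ≡⟨ cong (q * k *_) x≡y ⟩
    q * k * (y + b * m)          ≡⟨ factor q k y b m ⟨
    q * k * y + q * b * (k * m)  ∎)
    where
    factor : ∀ q k x a m → q * k * x + q * a * (k * m) ≡ q * k * (x + a * m)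
    factor = solve-∀

  %-≡-mod : .{{_ : NonZero m}} → ∀ x → x % m ≡ x [mod m ]
  %-≡-mod x = congruent (x / m) 0 (trans (sym (m≡m%n+[m/n]*n x m)) (sym (+-identityʳ x)))

  ≡-mod⇒%≡ : .{{_ : NonZero m}} → ∀ {x y} → x ≡ y [mod m ] → x % m ≡ y % m
  ≡-mod⇒%≡ {x} {y} (congruent a b x≡y) = begin
    x % m            ≡⟨ [m+kn]%n≡m%n x a m ⟨
    (x + a * m) % m  ≡⟨ cong (_% m) x≡y ⟩
    (y + b * m) % m  ≡⟨ [m+kn]%n≡m%n y b m ⟩
    y % m            ∎

  ≡-mod⇒≡ : .{{_ : NonZero m}} → ∀ {x y} → x < m → y < m → x ≡ y [mod m ] → x ≡ y
  ≡-mod⇒≡ {x} {y} x<m y<m x≡y = begin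
    x      ≡⟨ m<n⇒m%n≡m x<m ⟨
    x % m  ≡⟨ ≡-mod⇒%≡ x≡y ⟩
    y % m  ≡⟨ m<n⇒m%n≡m y<m ⟩
    y      ∎

≡-mod-setoid : ℕ → Setoid 0ℓ 0ℓ
≡-mod-setoid m = record
  { Carrier       = ℕ
  ; _≈_           = _≡_[mod m ]
  ; isEquivalence = record { refl = ≡-mod-refl ; sym = ≡-mod-sym ; trans = ≡-mod-trans }
  }

module ≡-mod-Reasoning (m : ℕ) = SetoidReasoning (≡-mod-setoid m)

linear-congruence-mod-prime : ∀ {p v} .{{_ : NonZero p}} .{{_ : NonZero v}} → Prime p → v < p →
                              ∀ x → Σ (Fin p) λ t → v * toℕ t + x ≡ 0 [mod p ]
linear-congruence-mod-prime {p} {v} pr v<p x with solution (coprime-Bézout (prime⇒coprime pr v<p))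
  where
  open ≡-Reasoning
  solution : Bézout.Identity 1 p v → ∃ λ t → p ∣ v * t + x
  solution (Bézout.+- x′ y′ 1+y′v≡x′p) = y′ * x , divides (x * x′) (begin
    v * (y′ * x) + x  ≡⟨ rearrange v y′ x ⟩
    x * (1 + y′ * v)  ≡⟨ cong (x *_) 1+y′v≡x′p ⟩
    x * (x′ * p)      ≡⟨ *-assoc x x′ p ⟨
    x * x′ * p        ∎)
    where
    rearrange : ∀ v y′ x → v * (y′ * x) + x ≡ x * (1 + y′ * v)
    rearrange = solve-∀
  -- here k = (p ∸ 1) * x is −x modulo p
  solution (Bézout.-+ x′ y′ 1+x′p≡y′v) = y′ * k , divides (x + x′ * k) (begin
    v * (y′ * k) + x          ≡⟨ cong (_+ x) (rearrange v y′ k) ⟩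
    y′ * v * k + x            ≡⟨ cong (λ z → z * k + x) 1+x′p≡y′v ⟨
    (1 + x′ * p) * k + x      ≡⟨ expand x′ p k x ⟩
    (k + x) + x′ * k * p      ≡⟨ cong (_+ x′ * k * p) k+x≡p*x ⟩
    p * x + x′ * k * p        ≡⟨ collect p x x′ k ⟩
    (x + x′ * k) * p          ∎)
    where
    k : ℕ
    k = (p ∸ 1) * x
    k+x≡p*x : k + x ≡ p * x
    k+x≡p*x = begin
      (p ∸ 1) * x + x      ≡⟨ cong ((p ∸ 1) * x +_) (*-identityˡ x) ⟨
      (p ∸ 1) * x + 1 * x  ≡⟨ *-distribʳ-+ x (p ∸ 1) 1 ⟨
      (p ∸ 1 + 1) * x      ≡⟨ cong (_* x) (m∸n+n≡m (>-nonZero⁻¹ p)) ⟩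
      p * x                ∎
    rearrange : ∀ v y′ k → v * (y′ * k) ≡ y′ * v * k
    rearrange = solve-∀
    expand : ∀ x′ p k x → (1 + x′ * p) * k + x ≡ (k + x) + x′ * k * p
    expand = solve-∀
    collect : ∀ p x x′ k → p * x + x′ * k * p ≡ (x + x′ * k) * p
    collect = solve-∀
... | t , p∣vt+x = t mod p , ≡-mod-trans (+-congʳ-mod x (*-congˡ-mod v digit≡t)) (∣⇒≡0-mod p∣vt+x)
  where
  digit≡t : toℕ (t mod p) ≡ t [mod p ]
  digit≡t = ≡-mod-trans (≡⇒≡-mod (toℕ-fromℕ< (m%n<n t p))) (%-≡-mod t)

module _ (p : ℕ) .{{_ : NonZero p}} where
  open Padic p

  res-< : ∀ x n → res x n < p ^ n
  res-< x zero    = z<s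
  res-< x (suc n) = <-≤-trans (+-monoˡ-< (toℕ (x n) * p ^ n) (res-< x n)) (*-monoˡ-≤ (p ^ n) (toℕ<n (x n)))

  res-suc : ∀ x n → res x (suc n) ≡ res x n [mod p ^ n ]
  res-suc x n = +-*-mod (res x n) (toℕ (x n))

  Coherent : (ℕ → ℕ) → Set
  Coherent r = ∀ n → r (suc n) ≡ r n [mod p ^ n ]

  res-fromRes : ∀ {r} → Coherent r → ∀ n → res (fromRes r) n ≡ (r n % p ^ n) {{m^n≢0 p n}}
  res-fromRes {r} coh zero    = sym (n%1≡0 (r 0))
  res-fromRes {r} coh (suc n) = begin
    res (fromRes r) n + toℕ (fromRes r n) * P
      ≡⟨ cong₂ (λ s t → s + t * P) (res-fromRes coh n) (toℕ-fromℕ< (m%n<n (x / P) p)) ⟩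
    r n % P + x / P % p * P
      ≡⟨ cong (_+ x / P % p * P) (≡-mod⇒%≡ (coh n)) ⟨
    x % P + x / P % p * P
      ≡⟨ cong₂ (λ s t → s + t * P) (m∣n⇒o%n%m≡o%m P (p * P) x (n∣m*n p)) (m%[n*o]/o≡m/o%n x p P) ⟨
    x % (p * P) % P + x % (p * P) / P * P
      ≡⟨ m≡m%n+[m/n]*n (x % (p * P)) P ⟨
    x % (p * P)
      ∎
    where
    open ≡-Reasoning
    P x : ℕ
    P = p ^ n
    x = r (suc n)
    instance _ = m^n≢0 p n ; _ = m^n≢0 p (suc n)

  infix 4 _HasResidues_
  _HasResidues_ : ℤp → (ℕ → ℕ) → Set
  x HasResidues r = ∀ n → res x n ≡ r n [mod p ^ n ]

  fromRes-residues : ∀ {r} → Coherent r → fromRes r HasResidues r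
  fromRes-residues {r} coh n = ≡-mod-trans (≡⇒≡-mod (res-fromRes coh n)) (%-≡-mod {{m^n≢0 p n}} (r n))

  res-residues : ∀ x → x HasResidues res x
  res-residues x n = ≡-mod-refl

  ℕ→ℤp-residues : ∀ m → ℕ→ℤp m HasResidues (λ _ → m)
  ℕ→ℤp-residues m = fromRes-residues (λ _ → ≡-mod-refl)

  +ᶻ-residues : ∀ {x y r s} → x HasResidues r → y HasResidues s → x +ᶻ y HasResidues (λ n → r n + s n)
  +ᶻ-residues {x} {y} x∼r y∼s n = ≡-mod-trans
    (fromRes-residues (λ n → +-cong-mod (res-suc x n) (res-suc y n)) n) (+-cong-mod (x∼r n) (y∼s n))

  *ᶻ-residues : ∀ {x y r s} → x HasResidues r → y HasResidues s → x *ᶻ y HasResidues (λ n → r n * s n)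
  *ᶻ-residues {x} {y} x∼r y∼s n = ≡-mod-trans
    (fromRes-residues (λ n → *-cong-mod (res-suc x n) (res-suc y n)) n) (*-cong-mod (x∼r n) (y∼s n))

  res-injective : ∀ {x y} → (∀ n → res x n ≡ res y n) → x ≈ᶻ y
  res-injective {x} {y} eq n = toℕ-injective (*-cancelʳ-≡ _ _ (p ^ n) {{m^n≢0 p n}} (+-cancelˡ-≡ (res x n) _ _ (begin
    res x n + toℕ (x n) * p ^ n  ≡⟨ eq (suc n) ⟩
    res y n + toℕ (y n) * p ^ n  ≡⟨ cong (_+ toℕ (y n) * p ^ n) (eq n) ⟨
    res x n + toℕ (y n) * p ^ n  ∎)))
    where open ≡-Reasoning

  res-cong : ∀ {x y} → x ≈ᶻ y → ∀ n → res x n ≡ res y n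
  res-cong x≈y zero    = refl
  res-cong x≈y (suc n) = cong₂ (λ r t → r + toℕ t * p ^ n) (res-cong x≈y n) (x≈y n)

  residues⇒≈ᶻ : ∀ {x y r s} → x HasResidues r → y HasResidues s →
                 (∀ n → r n ≡ s n [mod p ^ n ]) → x ≈ᶻ y
  residues⇒≈ᶻ {x} {y} x∼r y∼s r≡s = res-injective λ n → ≡-mod⇒≡ {{m^n≢0 p n}} (res-< x n) (res-< y n)
    (≡-mod-trans (x∼r n) (≡-mod-trans (r≡s n) (≡-mod-sym (y∼s n))))

  shift : ℕ → ℤp → ℤp
  shift j u i = u (i + j)

  res-+ : ∀ u m n → res u (m + n) ≡ res u n + res (shift n u) m * p ^ n
  res-+ u zero    n = sym (+-identityʳ (res u n))
  res-+ u (suc m) n = begin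
    res u (m + n) + t * p ^ (m + n)                          ≡⟨ cong₂ (λ r q → r + t * q) (res-+ u m n) (^-distribˡ-+-* p m n) ⟩
    res u n + res (shift n u) m * p ^ n + t * (p ^ m * p ^ n) ≡⟨ factor (res u n) (res (shift n u) m) t (p ^ m) (p ^ n) ⟩
    res u n + (res (shift n u) m + t * p ^ m) * p ^ n        ∎
    where
    open ≡-Reasoning
    t : ℕ
    t = toℕ (u (m + n))
    factor : ∀ r s t q P → r + s * P + t * (q * P) ≡ r + (s + t * q) * P
    factor = solve-∀

  shift-residues : ∀ j u → res u j ≡ 0 → u HasResidues (λ n → res (shift j u) n * p ^ j)
  shift-residues j u res≡0 n = begin
    res u n                                    ≈⟨ +-*-mod (res u n) (res (shift n u) j) ⟨
    res u n + res (shift n u) j * p ^ n        ≡⟨ res-+ u j n ⟨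
    res u (j + n)                              ≡⟨ cong (res u) (+-comm j n) ⟩
    res u (n + j)                              ≡⟨ res-+ u n j ⟩
    res u j + res (shift j u) n * p ^ j        ≡⟨ cong (_+ res (shift j u) n * p ^ j) res≡0 ⟩
    res (shift j u) n * p ^ j                  ∎
    where open ≡-mod-Reasoning (p ^ n)

  res-suc≡digit₀ : ∀ u n → res u (suc n) ≡ toℕ (u 0) [mod p ]
  res-suc≡digit₀ u zero    = ≡⇒≡-mod (*-identityʳ (toℕ (u 0)))
  res-suc≡digit₀ u (suc n) = begin
    res u (suc n) + t * (p * p ^ n)  ≡⟨ cong (res u (suc n) +_) (trans (cong (t *_) (*-comm p (p ^ n))) (sym (*-assoc t (p ^ n) p))) ⟩
    res u (suc n) + t * p ^ n * p    ≈⟨ +-*-mod (res u (suc n)) (t * p ^ n) ⟩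
    res u (suc n)                    ≈⟨ res-suc≡digit₀ u n ⟩
    toℕ (u 0)                        ∎
    where
    open ≡-mod-Reasoning p
    t : ℕ
    t = toℕ (u (suc n))

  leading-digit : ∀ u k → res u k ≡ 0 ⊎ ∃ λ j → j < k × res u j ≡ 0 × toℕ (u j) ≢ 0
  leading-digit u zero = inj₁ refl
  leading-digit u (suc k) with leading-digit u k
  ... | inj₂ (j , j<k , leading) = inj₂ (j , m<n⇒m<1+n j<k , leading)
  ... | inj₁ res≡0 with toℕ (u k) ≟ 0
  ...   | yes digit≡0 = inj₁ (cong₂ (λ r t → r + t * p ^ k) res≡0 digit≡0)
  ...   | no  digit≢0 = inj₂ (k , n<1+n k , res≡0 , digit≢0)

  res≡0⇒integral : ∀ k u → res u k ≡ 0 → Integral (k , u)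
  res≡0⇒integral k u res≡0 = shift k u , residues⇒≈ᶻ
    (*ᶻ-residues (ℕ→ℤp-residues 1) (shift-residues k u res≡0))
    (*ᶻ-residues (ℕ→ℤp-residues (p ^ k)) (res-residues (shift k u)))
    (λ n → ≡⇒≡-mod (trans (*-identityˡ _) (*-comm _ (p ^ k))))

  infix 4 _HasResidues_/p^_
  record _HasResidues_/p^_ (x : ℚp) (r : ℕ → ℕ) (k : ℕ) : Set where
    constructor expansion
    field
      exponent  : proj₁ x ≡ k
      numerator : proj₂ x HasResidues r

  ι-residues : ∀ {x r} → x HasResidues r → ι x HasResidues r /p^ 0
  ι-residues = expansion refl

  +ℚ-residues : ∀ {x y r s k l} → x HasResidues r /p^ k → y HasResidues s /p^ l →
                x +ℚ y HasResidues (λ n → p ^ l * r n + p ^ k * s n) /p^ (k + l)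
  +ℚ-residues (expansion refl x∼r) (expansion refl y∼s) = expansion refl
    (+ᶻ-residues (*ᶻ-residues (ℕ→ℤp-residues _) x∼r) (*ᶻ-residues (ℕ→ℤp-residues _) y∼s))

  *ℚ-residues : ∀ {x y r s k l} → x HasResidues r /p^ k → y HasResidues s /p^ l →
                x *ℚ y HasResidues (λ n → r n * s n) /p^ (k + l)
  *ℚ-residues (expansion refl x∼r) (expansion refl y∼s) = expansion refl (*ᶻ-residues x∼r y∼s)

  ι-^ℚ-residues : ∀ {x r} → x HasResidues r → ∀ e → ι x ^ℚ e HasResidues (λ n → r n ^ e) /p^ 0
  ι-^ℚ-residues x∼r zero    = ι-residues (ℕ→ℤp-residues 1)
  ι-^ℚ-residues x∼r (suc e) = *ℚ-residues (ι-residues x∼r) (ι-^ℚ-residues x∼r e)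

  residues⇒≈0ℚ : ∀ {x r k} → x HasResidues r /p^ k → (∀ n → p ^ n ∣ r n) → x ≈ 0ℚ
  residues⇒≈0ℚ {x} (expansion _ x∼r) p^n∣r = residues⇒≈ᶻ
    (*ᶻ-residues (ℕ→ℤp-residues 1) x∼r) (*ᶻ-residues (ℕ→ℤp-residues (p ^ proj₁ x)) (ℕ→ℤp-residues 0))
    (λ n → ≡-mod-trans (≡⇒≡-mod (*-identityˡ _)) (≡-mod-trans (∣⇒≡0-mod (p^n∣r n)) (≡⇒≡-mod (sym (*-zeroʳ (p ^ proj₁ x))))))

  1ℚ≉0ℚ : 1 < p → ¬ 1ℚ ≈ 0ℚ
  1ℚ≉0ℚ 1<p 1≈0 = 1+n≢0 (≡-mod⇒≡ {{m^n≢0 p 1}} 1<p¹ (<-trans z<s 1<p¹) 1≡0)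
    where
    1<p¹ : 1 < p ^ 1
    1<p¹ = subst (1 <_) (sym (*-identityʳ p)) 1<p
    1≡0 : 1 ≡ 0 [mod p ^ 1 ]
    1≡0 = begin
      1                              ≈⟨ *ᶻ-residues (ℕ→ℤp-residues 1) (ℕ→ℤp-residues 1) 1 ⟨
      res (ℕ→ℤp 1 *ᶻ ℕ→ℤp 1) 1      ≡⟨ res-cong 1≈0 1 ⟩
      res (ℕ→ℤp 1 *ᶻ ℕ→ℤp 0) 1      ≈⟨ *ᶻ-residues (ℕ→ℤp-residues 1) (ℕ→ℤp-residues 0) 1 ⟩
      0                              ∎
      where open ≡-mod-Reasoning (p ^ 1)

  digits-by-lifting : (P : ℕ → ℕ → Set) → P 0 0 →
                      (∀ n S → P n S → Σ (Fin p) λ t → P (suc n) (S + toℕ t * p ^ n)) →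
                      Σ ℤp λ T → ∀ n → P n (res T n)
  digits-by-lifting P P₀ lift = T , λ n → subst (P n) (sym (res-T n)) (proj₂ (approx n))
    where
    approx : ∀ n → Σ ℕ (P n)
    approx zero    = 0 , P₀
    approx (suc n) = let (S , PS) = approx n ; (t , Pt) = lift n S PS in S + toℕ t * p ^ n , Pt
    T : ℤp
    T n = proj₁ (lift n (proj₁ (approx n)) (proj₂ (approx n)))
    res-T : ∀ n → res T n ≡ proj₁ (approx n)
    res-T zero    = refl
    res-T (suc n) = cong (_+ toℕ (T n) * p ^ n) (res-T n)

  hensel : Prime p → ∀ E → p ∣ E → (a u c : ℤp) (d : ℕ) → toℕ (u 0) ≢ 0 →
           Σ ℤp λ T → ∀ n → p ^ n ∣ E * (res a n * res T n ^ d) + res u n * res T n + res c n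
  hensel pr E p∣E a u c d u₀≢0 = digits-by-lifting (λ n S → p ^ n ∣ H n S) (1∣ H 0 0) lift
    where
    H : ℕ → ℕ → ℕ
    H n S = E * (res a n * S ^ d) + res u n * S + res c n

    -- Since p ∣ E, H (suc n) (S + t p^n) ≡ (u₀ t + X) p^n (mod p^(n+1)), where X does
    -- not depend on t; so t is chosen to solve the linear congruence u₀ t + X ≡ 0 (mod p).
    lift : ∀ n S → p ^ n ∣ H n S → Σ (Fin p) λ t → p ^ suc n ∣ H (suc n) (S + toℕ t * p ^ n)
    lift n S (divides q Hn≡qP) = t , ≡0-mod⇒∣ (begin
      H (suc n) S′                        ≡⟨⟩
      E * (a′ * S′ ^ d) + u′ * S′ + c′    ≈⟨ +-congʳ-mod c′ (+-congʳ-mod (u′ * S′) (∣-scaleˡ-mod p∣E leading≡)) ⟩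
      E * (aₙ * S ^ d) + u′ * S′ + c′     ≡⟨ expand (E * (aₙ * S ^ d)) uₙ μ P S τ cₙ γ ⟩
      H n S + (u′ * τ + μ * S + γ) * P    ≡⟨ cong (_+ (u′ * τ + μ * S + γ) * P) Hn≡qP ⟩
      q * P + (u′ * τ + μ * S + γ) * P    ≡⟨ collect q u′ τ μ S γ P ⟩
      (u′ * τ + X) * P                    ≈⟨ *-scaleʳ-mod P (+-congʳ-mod X (*-cong-mod (res-suc≡digit₀ u n) ≡-mod-refl)) ⟩
      (toℕ (u 0) * τ + X) * P             ≈⟨ *-scaleʳ-mod P t-solves ⟩
      0                                   ∎)
      where
      open ≡-mod-Reasoning (p ^ suc n)
      P aₙ uₙ cₙ μ γ X : ℕ
      P  = p ^ n
      aₙ = res a n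
      uₙ = res u n
      cₙ = res c n
      μ  = toℕ (u n)
      γ  = toℕ (c n)
      X  = q + μ * S + γ
      instance _ = ≢-nonZero u₀≢0
      t-sol : Σ (Fin p) λ t → toℕ (u 0) * toℕ t + X ≡ 0 [mod p ]
      t-sol = linear-congruence-mod-prime pr (toℕ<n (u 0)) X
      t : Fin p
      t = proj₁ t-sol
      t-solves : toℕ (u 0) * toℕ t + X ≡ 0 [mod p ]
      t-solves = proj₂ t-sol
      τ S′ a′ u′ c′ : ℕ
      τ  = toℕ t
      S′ = S + τ * P
      a′ = res a (suc n)
      u′ = res u (suc n)
      c′ = res c (suc n)
      leading≡ : a′ * S′ ^ d ≡ aₙ * S ^ d [mod P ]
      leading≡ = *-cong-mod (res-suc a n) (^-cong-mod d (+-*-mod S τ))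
      expand : ∀ A uₙ μ P S t cₙ γ → A + (uₙ + μ * P) * (S + t * P) + (cₙ + γ * P)
                                    ≡ A + uₙ * S + cₙ + ((uₙ + μ * P) * t + μ * S + γ) * P
      expand = solve-∀
      collect : ∀ q u′ t μ S γ P → q * P + (u′ * t + μ * S + γ) * P ≡ (u′ * t + (q + μ * S + γ)) * P
      collect = solve-∀

  FormHasNontrivialZero : ℕ → ℤp → ℚp → ℤp → Set
  FormHasNontrivialZero d a b c = ∃ λ α → ∃ λ β → ¬ (α ≈ 0ℚ × β ≈ 0ℚ) ×
    (ι a *ℚ α ^ℚ d +ℚ b *ℚ α *ℚ β ^ℚ (d ∸ 1) +ℚ ι c *ℚ β ^ℚ d ≈ 0ℚ)

  leading-digit⇒nontrivial-zero : Prime p → ∀ d j e (a u c : ℤp) → res u j ≡ 0 → toℕ (u j) ≢ 0 →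
                                  FormHasNontrivialZero (suc d) a (j + suc e , u) c
  leading-digit⇒nontrivial-zero pr d j e a u c res≡0 uⱼ≢0 = α , 1ℚ , (λ (_ , 1≈0) → 1ℚ≉0ℚ 1<p 1≈0) ,
    residues⇒≈0ℚ value-residues λ n → subst (p ^ n ∣_) (sym (value≡ n)) (∣n⇒∣m*n (p ^ (j + m)) (T-root n))
    where
    m : ℕ
    m = suc e
    u′ : ℤp
    u′ = shift j u
    H : ℕ → ℕ → ℕ
    H n S = p ^ (m * suc d) * (res a n * S ^ suc d) + res u′ n * S + res c n
    T-sol : Σ ℤp λ T → ∀ n → p ^ n ∣ H n (res T n)
    T-sol = hensel pr (p ^ (m * suc d)) (m∣m*n _) a u′ c (suc d) uⱼ≢0
    T : ℤp
    T = proj₁ T-sol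
    T-root : ∀ n → p ^ n ∣ H n (res T n)
    T-root = proj₂ T-sol
    α : ℚp
    α = ι (ℕ→ℤp (p ^ m) *ᶻ T)
    1<p : 1 < p
    1<p = nonTrivial⇒n>1 p {{prime⇒nonTrivial pr}}

    -- The factors `1 *` and summands `+ 0` come from the exponent 0 of the integral factors.
    value : ℕ → ℕ
    value n = 1 * (p ^ (j + m + 0 + 0) * (res a n * (p ^ m * res T n) ^ suc d)
                   + 1 * (res u′ n * p ^ j * (p ^ m * res T n) * 1 ^ d))
              + p ^ (j + m + 0 + 0) * (res c n * 1 ^ suc d)

    value-residues : ι a *ℚ α ^ℚ suc d +ℚ (j + m , u) *ℚ α *ℚ 1ℚ ^ℚ d +ℚ ι c *ℚ 1ℚ ^ℚ suc d
                       HasResidues value /p^ (j + m + 0 + 0 + 0)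
    value-residues = +ℚ-residues
      (+ℚ-residues
        (*ℚ-residues (ι-residues (res-residues a)) (ι-^ℚ-residues αᶻ-residues (suc d)))
        (*ℚ-residues (*ℚ-residues (expansion refl (shift-residues j u res≡0)) (ι-residues αᶻ-residues))
                     (ι-^ℚ-residues (ℕ→ℤp-residues 1) d)))
      (*ℚ-residues (ι-residues (res-residues c)) (ι-^ℚ-residues (ℕ→ℤp-residues 1) (suc d)))
      where
      αᶻ-residues : ℕ→ℤp (p ^ m) *ᶻ T HasResidues (λ n → p ^ m * res T n)
      αᶻ-residues = *ᶻ-residues (ℕ→ℤp-residues (p ^ m)) (res-residues T)

    value≡ : ∀ n → value n ≡ p ^ (j + m) * H n (res T n)
    value≡ n = substitution (res a n) (res u′ n) (res c n) (res T n)
      where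
      substitution : ∀ a u c S →
        1 * (p ^ (j + m + 0 + 0) * (a * (p ^ m * S) ^ suc d) + 1 * (u * p ^ j * (p ^ m * S) * 1 ^ d))
          + p ^ (j + m + 0 + 0) * (c * 1 ^ suc d)
        ≡ p ^ (j + m) * (p ^ (m * suc d) * (a * S ^ suc d) + u * S + c)
      substitution a u c S rewrite +-identityʳ (j + m + 0) | +-identityʳ (j + m) | ^-zeroˡ d
                   | ^-distribʳ-* (p ^ m) S (suc d) | ^-*-assoc p m (suc d) | ^-distribˡ-+-* p j m =
        factor (p ^ j) (p ^ m) (p ^ (m * suc d)) a u c S (S ^ suc d)
        where
        factor : ∀ pʲ pᵐ pᵐᵈ a u c S Sᵈ →
          1 * (pʲ * pᵐ * (a * (pᵐᵈ * Sᵈ)) + 1 * (u * pʲ * (pᵐ * S) * 1)) + pʲ * pᵐ * (c * 1)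
          ≡ pʲ * pᵐ * (pᵐᵈ * (a * Sᵈ) + u * S + c)
        factor = solve-∀

lemma5 : (p : ℕ) .{{_ : NonZero p}} → Prime p → (d : ℕ) → 1 ≤ d →
    let open Padic p in
    (a c : ℤp) (b : ℚp) → ¬ Integral b →
    ∃ λ α → ∃ λ β → ¬ (α ≈ 0ℚ × β ≈ 0ℚ) ×
      (ι a *ℚ α ^ℚ d +ℚ b *ℚ α *ℚ β ^ℚ (d ∸ 1) +ℚ ι c *ℚ β ^ℚ d ≈ 0ℚ)
lemma5 p pr zero () a c b b∉ℤp
lemma5 p pr (suc d) _ a c (k , u) b∉ℤp = [ integral , non-integral ]′ (leading-digit p u k)
  where
  open Padic p
  integral : res u k ≡ 0 → FormHasNontrivialZero p (suc d) a (k , u) c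
  integral res≡0 = ⊥-elim (b∉ℤp (res≡0⇒integral p k u res≡0))
  non-integral : (∃ λ j → j < k × res u j ≡ 0 × toℕ (u j) ≢ 0) → FormHasNontrivialZero p (suc d) a (k , u) c
  non-integral (j , j<k , res≡0 , uⱼ≢0) =
    subst (λ k → FormHasNontrivialZero p (suc d) a (k , u) c) (trans (+-suc j e) 1+j+e≡k)
          (leading-digit⇒nontrivial-zero p pr d j e a u c res≡0 uⱼ≢0)
    where
    e : ℕ
    e = proj₁ (m≤n⇒∃[o]m+o≡n j<k)
    1+j+e≡k : suc j + e ≡ k
    1+j+e≡k = proj₂ (m≤n⇒∃[o]m+o≡n j<k)
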